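{- Let $\pi:\mathbb{N}\to\mathbb{N}$ be an injective function whose values are all prime numbers, and write $\pi_u$ for $\pi(u)$. Given $n:\mathbb{N}$ and a predicate $p:\mathbb{N}\to\mathbb{P}$ with $\forall x<n.\ p\,x\lor\neg p\,x$, we have $$\exists c:\mathbb{N}\ \forall u:\mathbb{N}.\ \big(u<n\to(p\,u\leftrightarrow \pi_u\mid c)\big)\land\big(\pi_u\mid c\to u<n\big).$$
   Context: Meta-theory: constructive type theory (Calculus of Inductive Constructions); $\mathbb{P}$ is the universe of propositions; no classical axioms (such as excluded middle) are assumed. $\mid$ is divisibility on $\mathbb{N}$. -}

module Defs where

-- Multiplying c by the prime π n adds exactly the index n to the set
-- {u : π u divides c}: by Euclid's lemma and injectivity of π, π u ∣ c * π n holds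
-- iff π u ∣ c or u ≡ n.  So c is the product of the π u with u < n and p u.
module Submission where

open import Defs
open import Data.Nat using (ℕ; zero; suc; _<_; _*_)
open import Data.Nat.Divisibility using (_∣_; ∣-trans; m∣m*n; n∣m*n; ∣1⇒≡1)
open import Data.Nat.Primality using (Prime; euclidsLemma; prime⇒irreducible; ¬prime[1])
open import Data.Nat.Properties using (m<1+n⇒m<n∨m≡n; <-irrefl; n<1+n; m<n⇒m<1+n)
open import Data.Product using (_×_; ∃-syntax; _,_; proj₁; proj₂)
open import Data.Sum using (_⊎_; inj₁; inj₂; [_,_])
open import Data.Empty using (⊥-elim)
open import Relation.Nullary using (¬_)
open import Relation.Binary.PropositionalEquality using (_≡_; refl; subst)
open import Function.Definitions using (Injective)
open import Function.Bundles using (_⇔_; mk⇔; Equivalence)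

prime∤1 : ∀ {q} → Prime q → ¬ q ∣ 1
prime∤1 q-prime q∣1 = ¬prime[1] (subst Prime (∣1⇒≡1 q∣1) q-prime)

prime∣prime⇒≡ : ∀ {q r} → Prime q → Prime r → q ∣ r → q ≡ r
prime∣prime⇒≡ q-prime r-prime q∣r with prime⇒irreducible r-prime q∣r
... | inj₁ q≡1 = ⊥-elim (¬prime[1] (subst Prime q≡1 q-prime))
... | inj₂ q≡r = q≡r

module _ (π : ℕ → ℕ) (π-injective : Injective _≡_ _≡_ π) (π-prime : ∀ u → Prime (π u)) where

  Encodes : (p : ℕ → Set) → ℕ → ℕ → Set
  Encodes p n c = ∀ u → (u < n → (p u ⇔ (π u ∣ c))) × (π u ∣ c → u < n)

  π∣π⇒≡ : ∀ {u v} → π u ∣ π v → u ≡ v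
  π∣π⇒≡ {u} {v} d = π-injective (prime∣prime⇒≡ (π-prime u) (π-prime v) d)

  π∣*π⇒π∣⊎≡ : ∀ {u v} c → π u ∣ c * π v → π u ∣ c ⊎ u ≡ v
  π∣*π⇒π∣⊎≡ {u} {v} c d = [ inj₁ , (λ π-u∣π-v → inj₂ (π∣π⇒≡ π-u∣π-v)) ]
                            (euclidsLemma c (π v) (π-prime u) d)

  encodes-zero : ∀ p → Encodes p 0 1
  encodes-zero p u = (λ ()) , λ π-u∣1 → ⊥-elim (prime∤1 (π-prime u) π-u∣1)

  encodes-suc-yes : ∀ {p n c} → p n → Encodes p n c → Encodes p (suc n) (c * π n)
  encodes-suc-yes {p} {n} {c} pn enc u = ⇔-below , bounded
    where
    ⇔-below : u < suc n → p u ⇔ (π u ∣ c * π n)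
    ⇔-below u<1+n with m<1+n⇒m<n∨m≡n u<1+n
    ... | inj₂ refl = mk⇔ (λ _ → n∣m*n c) (λ _ → pn)
    ... | inj₁ u<n = mk⇔ (λ pu → ∣-trans (Equivalence.to (proj₁ (enc u) u<n) pu) (m∣m*n (π n)))
                         (λ d → [ Equivalence.from (proj₁ (enc u) u<n)
                                , (λ { refl → ⊥-elim (<-irrefl refl u<n) }) ]
                                (π∣*π⇒π∣⊎≡ c d))
    bounded : π u ∣ c * π n → u < suc n
    bounded d = [ (λ π-u∣c → m<n⇒m<1+n (proj₂ (enc u) π-u∣c)) , (λ { refl → n<1+n n }) ]
                (π∣*π⇒π∣⊎≡ c d)

  encodes-suc-no : ∀ {p n c} → ¬ p n → Encodes p n c → Encodes p (suc n) c
  encodes-suc-no {p} {n} {c} ¬pn enc u = ⇔-below , λ d → m<n⇒m<1+n (proj₂ (enc u) d)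
    where
    ⇔-below : u < suc n → p u ⇔ (π u ∣ c)
    ⇔-below u<1+n with m<1+n⇒m<n∨m≡n u<1+n
    ... | inj₂ refl = mk⇔ (λ pn → ⊥-elim (¬pn pn)) (λ d → ⊥-elim (<-irrefl refl (proj₂ (enc n) d)))
    ... | inj₁ u<n = proj₁ (enc u) u<n

  encoding : ∀ (p : ℕ → Set) n → (∀ x → x < n → p x ⊎ ¬ p x) → ∃[ c ] Encodes p n c
  encoding p zero    dec = 1 , encodes-zero p
  encoding p (suc n) dec with encoding p n (λ x x<n → dec x (m<n⇒m<1+n x<n)) | dec n (n<1+n n)
  ... | c , enc | inj₁ pn  = c * π n , encodes-suc-yes pn enc
  ... | c , enc | inj₂ ¬pn = c , encodes-suc-no ¬pn enc

lemma5p1 : (π : ℕ → ℕ) → Injective _≡_ _≡_ π → (∀ u → Prime (π u))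
    → (n : ℕ) → (p : ℕ → Set) → (∀ x → x < n → p x ⊎ ¬ p x)
    → ∃[ c ] (∀ u → ((u < n → (p u ⇔ (π u ∣ c))) × (π u ∣ c → u < n)))
lemma5p1 π π-injective π-prime n p dec = encoding π π-injective π-prime p n dec
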